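{- Let $k\geq 2$, let $u$ be an integer with $1\leq u\leq k-1$, and let $h_1\geq h_k$ be positive integers. If an $\mathrm{LS}(h_1^ih_k^{k-i})$ exists for every integer $i$ with $u\leq i\leq k-1$, then an $\mathrm{ROS}(h_1^u g_1\dots g_{k-u-1} h_k)$ exists for every sequence of integers $g_1,\dots,g_{k-u-1}$ with $h_1\geq g_1\geq\dots\geq g_{k-u-1}\geq h_k$.
   Context: The notation $h^m$ means $m$ parts equal to $h$. For positive integers $p_1,\dots,p_k$ with $n=\sum_i p_i$, an $\mathrm{LS}(p_1\dots p_k)$ is a latin square of order $n$ containing $k$ pairwise disjoint subsquares of orders $p_1,\dots,p_k$ (a subsquare is a square subarray which is itself a latin square; disjoint means sharing no rows, columns or symbols). Given a sequence $P=(p_1,\dots,p_k)$ of positive integers, an $\mathrm{ROS}(P)$ is an assignment of a non-negative rational number $O(i,j,\ell)$ to every multiset $\{i,j,\ell\}$ of elements of $[k]$ (invariant under permuting $i,j,\ell$) such that $\sum_{\ell\in[k]}O(i,j,\ell)=p_ip_j$ for all $i,j\in[k]$, and $O(i,i,i)=p_i^2$ and $O(i,i,j)=0$ for all $i\neq j$. -}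

module Defs where

open import Data.Nat using (ℕ; zero; suc; _*_; _≤_)
open import Data.Fin using (Fin)
import Data.Fin as Fin
open import Data.Vec using (Vec; lookup; sum)
open import Data.Integer using (+_)
open import Data.Rational using (ℚ; 0ℚ; _/_; _+_) renaming (_≤_ to _≤ℚ_)
open import Data.Product using (Σ; ∃; _×_; _,_)
open import Function.Definitions using (Injective)
open import Relation.Binary.PropositionalEquality using (_≡_; _≢_)

-- A latin square of order n on symbol set Fin n: every symbol occurs at most
-- (hence, by counting, exactly) once in each row and in each column.
IsLatinSquare : (n : ℕ) → (Fin n → Fin n → Fin n) → Set
IsLatinSquare n L =
  (∀ r → Injective _≡_ _≡_ (L r)) × (∀ c → Injective _≡_ _≡_ (λ r → L r c))

-- A subsquare of order p of L: p distinct rows, p distinct columns and p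
-- distinct symbols such that the p×p subarray only uses these symbols
-- (so it is itself a latin square on them).
record Subsquare (n : ℕ) (L : Fin n → Fin n → Fin n) (p : ℕ) : Set where
  field
    rows cols syms : Fin p → Fin n
    rows-inj : Injective _≡_ _≡_ rows
    cols-inj : Injective _≡_ _≡_ cols
    syms-inj : Injective _≡_ _≡_ syms
    closed   : ∀ a b → ∃ λ c → L (rows a) (cols b) ≡ syms c
open Subsquare public

-- LS(p_1 … p_k): a latin square of order n = Σ p_i with k pairwise disjoint
-- subsquares of orders p_1, …, p_k.
LS : ∀ {k} → Vec ℕ k → Set
LS {k} P =
  Σ (Fin (sum P) → Fin (sum P) → Fin (sum P)) λ L →
  IsLatinSquare (sum P) L ×
  Σ ((i : Fin k) → Subsquare (sum P) L (lookup P i)) λ S →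
    ∀ i j → i ≢ j →
      (∀ a b → rows (S i) a ≢ rows (S j) b) ×
      (∀ a b → cols (S i) a ≢ cols (S j) b) ×
      (∀ a b → syms (S i) a ≢ syms (S j) b)

ℕtoℚ : ℕ → ℚ
ℕtoℚ n = + n / 1

Σℚ : ∀ {k} → (Fin k → ℚ) → ℚ
Σℚ {zero}  f = 0ℚ
Σℚ {suc k} f = f Fin.zero + Σℚ (λ i → f (Fin.suc i))

-- ROS(P): a non-negative rational function on multisets {i,j,ℓ} of [k]
-- (a function on triples invariant under permutations) with the stated sums.
record ROS {k} (P : Vec ℕ k) : Set where
  field
    O      : Fin k → Fin k → Fin k → ℚ
    sym₁₂  : ∀ i j l → O i j l ≡ O j i l
    sym₂₃  : ∀ i j l → O i j l ≡ O i l j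
    nonneg : ∀ i j l → 0ℚ ≤ℚ O i j l
    rowsum : ∀ i j → Σℚ (λ l → O i j l) ≡ ℕtoℚ (lookup P i * lookup P j)
    diag   : ∀ i → O i i i ≡ ℕtoℚ (lookup P i * lookup P i)
    offdiag : ∀ i j → i ≢ j → O i i j ≡ 0ℚ

-- In an LS(p₁ … pₖ) with subsquares S₁, …, Sₖ, let N(i,j,l) count the cells
-- in the rows of Sᵢ and the columns of Sⱼ whose symbol belongs to Sₗ.  Rows,
-- columns and symbols are each partitioned by the subsquares and every line
-- of a latin square is a bijection, so summing N over any one index gives
-- the product of the other two orders; symmetrising N over the six
-- permutations of (i,j,l) therefore gives 6·O for an ROS(p₁ … pₖ).
-- Apart from O(i,i,i), which the other values determine, the ROS conditions
-- are linear in O, with right-hand sides pᵢpⱼ (i ≠ j) linear in each single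
-- part.  Hence if two ROSs have the same parts except one, equal to lo and
-- hi, a convex combination of them is an ROS whose part there is any given
-- value between lo and hi.  Starting from the ROSs of the LS(h₁ᶜ hₖᵏ⁻ᶜ),
-- u ≤ c ≤ k - 1, the parts g₁, g₂, … are inserted one at a time in this way,
-- each between an extra h₁ and an extra hₖ; their order is irrelevant since
-- the ROS conditions are invariant under permuting the parts.

module Submission where

open import Defs
open import Data.Nat using (ℕ; zero; suc; _*_; _≤_; _∸_; _+_; s≤s; z≤n; NonZero)
import Data.Nat.Properties as ℕ
open import Data.Nat.Solver using (module +-*-Solver)
open import Data.Fin using (Fin; zero; suc; _≟_; punchIn; splitAt)
import Data.Fin as Fin
import Data.Fin.Properties as Fin
open import Data.Fin.Permutation as Perm using (Permutation; _⟨$⟩ʳ_)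
import Data.Integer as ℤ
import Data.Integer.Properties as ℤ
open import Data.Rational as ℚ using (ℚ; 0ℚ; 1ℚ; 1/_)
import Data.Rational.Properties as ℚ
import Data.Rational.Unnormalised as ℚᵘ
import Data.Rational.Unnormalised.Properties as ℚᵘ
open import Data.Empty using (⊥-elim)
open import Data.List as List using (List)
import Data.List.Relation.Binary.Permutation.Propositional as List
import Data.List.Relation.Binary.Permutation.Propositional.Properties as List
open import Data.Product using (∃; ∃₂; _×_; _,_; proj₁; proj₂)
open import Data.Sum using (inj₁; inj₂; [_,_]′)
open import Data.Sum.Properties using ([,]-map; [,]-∘)
open import Data.Vec using (Vec; []; _∷_; replicate; _++_; [_]; lookup; toList)
import Data.Vec as Vec
import Data.Vec.Properties as Vec
open import Data.Vec.Functional as Vector using (Vector)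
open import Data.Vec.Functional.Relation.Binary.Permutation using (_↭_)
open import Data.Vec.Functional.Relation.Binary.Permutation.Properties using (↭-sym)
open import Function using (_∘_; case_of_; it)
open import Function.Bundles using (Injection)
open import Function.Definitions using (Injective)
open import Function.Properties.Inverse using (↔⇒↣)
open import Relation.Binary.PropositionalEquality hiding ([_])
open import Relation.Nullary using (¬_; yes; no; contradiction)
open import Relation.Nullary.Decidable using (_×-dec_)
open import Algebra.Properties.Semiring.Sum ℕ.+-*-semiring
  using (sum; sum-syntax; sum-cong-≗; sum-remove; ∑-comm; ∑-distrib-+; ∑-permute; *-distribˡ-sum)

private variable
  k m n : ℕ
  A : Set

∑-const : ∀ n c → ∑[ x < n ] c ≡ n * c
∑-const zero    c = refl
∑-const (suc n) c = cong (c +_) (∑-const n c)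

∑-zero : (f : Fin n → ℕ) → (∀ x → f x ≡ 0) → sum f ≡ 0
∑-zero {n} f f≡0 = trans (sum-cong-≗ {n} {f} f≡0) (trans (∑-const n 0) (ℕ.*-zeroʳ n))

∑-support : (f : Fin n → ℕ) (i : Fin n) → (∀ l → l ≢ i → f l ≡ 0) → sum f ≡ f i
∑-support {suc n} f i zero-elsewhere = begin
  sum f                      ≡⟨ sum-remove f ⟩
  f i + sum (f ∘ punchIn i)  ≡⟨ cong (f i +_) (∑-zero _ (λ l → zero-elsewhere _ (Fin.punchInᵢ≢i i l))) ⟩
  f i + 0                    ≡⟨ ℕ.+-identityʳ (f i) ⟩
  f i                        ∎
  where open ≡-Reasoning

∑≡0⇒≡0 : (f : Fin n → ℕ) → sum f ≡ 0 → ∀ l → f l ≡ 0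
∑≡0⇒≡0 f eq zero    = ℕ.m+n≡0⇒m≡0 (f zero) eq
∑≡0⇒≡0 f eq (suc l) = ∑≡0⇒≡0 (f ∘ suc) (ℕ.m+n≡0⇒n≡0 (f zero) eq) l

∑≡term⇒others≡0 : (f : Fin n → ℕ) (i : Fin n) → sum f ≡ f i → ∀ l → l ≢ i → f l ≡ 0
∑≡term⇒others≡0 {suc n} f i eq l l≢i = begin
  f l                                      ≡⟨ cong f (Fin.punchIn-punchOut (l≢i ∘ sym)) ⟨
  f (punchIn i (Fin.punchOut (l≢i ∘ sym)))  ≡⟨ ∑≡0⇒≡0 (f ∘ punchIn i) rest≡0 _ ⟩
  0                                        ∎
  where
  open ≡-Reasoning
  rest≡0 : sum (f ∘ punchIn i) ≡ 0
  rest≡0 = ℕ.+-cancelˡ-≡ (f i) _ 0 (trans (sym (sum-remove f)) (trans eq (sym (ℕ.+-identityʳ (f i)))))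

∑∑-ones : ∀ m n (f : Fin m → Fin n → ℕ) → (∀ a b → f a b ≡ 1) → ∑[ a < m ] ∑[ b < n ] f a b ≡ m * n
∑∑-ones m n f f≡1 =
  trans (sum-cong-≗ {m} (λ a → trans (sum-cong-≗ {n} (f≡1 a)) (trans (∑-const n 1) (ℕ.*-identityʳ n))))
        (∑-const m n)

∑-++ : (xs : Vector ℕ m) (ys : Vector ℕ n) → sum (xs Vector.++ ys) ≡ sum xs + sum ys
∑-++ {zero}  xs ys = refl
∑-++ {suc m} xs ys = begin
  xs zero + sum ((xs Vector.++ ys) ∘ suc)  ≡⟨ cong (xs zero +_) (sum-cong-≗ (λ i → [,]-map (splitAt m i))) ⟩
  xs zero + sum ((xs ∘ suc) Vector.++ ys)  ≡⟨ cong (xs zero +_) (∑-++ (xs ∘ suc) ys) ⟩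
  xs zero + (sum (xs ∘ suc) + sum ys)      ≡⟨ ℕ.+-assoc (xs zero) _ _ ⟨
  sum xs + sum ys                          ∎
  where open ≡-Reasoning

injective⇒surjective : {f : Fin n → Fin n} → Injective _≡_ _≡_ f → ∀ y → ∃ λ x → f x ≡ y
injective⇒surjective {suc n} {f} f-inj y with Fin.any? (λ x → f x ≟ y)
... | yes hit = hit
... | no miss = contradiction (Fin.injective⇒≤ squeeze-inj) ℕ.1+n≰n
  where
  y≢f : ∀ x → y ≢ f x
  y≢f x eq = miss (x , sym eq)
  squeeze-inj : Injective _≡_ _≡_ (λ x → Fin.punchOut (y≢f x))
  squeeze-inj eq = f-inj (Fin.punchOut-injective (y≢f _) (y≢f _) eq)

injective⇒permutation : {f : Fin n → Fin n} → Injective _≡_ _≡_ f → Permutation n n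
injective⇒permutation {f = f} f-inj =
  Perm.permutation f (proj₁ ∘ surj) (proj₂ ∘ surj) (λ x → f-inj (proj₂ (surj (f x))))
  where
  surj : ∀ y → ∃ λ x → f x ≡ y
  surj = injective⇒surjective f-inj

∑-injective : {f : Fin n → Fin n} → Injective _≡_ _≡_ f → (g : Fin n → ℕ) → sum (g ∘ f) ≡ sum g
∑-injective f-inj g = sym (∑-permute g (injective⇒permutation f-inj))

[,]-injective : ∀ {B C : Set} {f : A → C} {g : B → C} →
  Injective _≡_ _≡_ f → Injective _≡_ _≡_ g → (∀ a b → f a ≢ g b) → Injective _≡_ _≡_ [ f , g ]′
[,]-injective f-inj g-inj f≢g {inj₁ a} {inj₁ a′} eq = cong inj₁ (f-inj eq)
[,]-injective f-inj g-inj f≢g {inj₁ a} {inj₂ b}  eq = ⊥-elim (f≢g a b eq)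
[,]-injective f-inj g-inj f≢g {inj₂ b} {inj₁ a}  eq = ⊥-elim (f≢g a b (sym eq))
[,]-injective f-inj g-inj f≢g {inj₂ b} {inj₂ b′} eq = cong inj₂ (g-inj eq)

splitAt-injective : ∀ m → Injective _≡_ _≡_ (splitAt m {n})
splitAt-injective m {x} {y} eq =
  trans (sym (Fin.join-splitAt m _ x)) (trans (cong (Fin.join m _) eq) (Fin.join-splitAt m _ y))

glue : (P : Vec ℕ k) → ((j : Fin k) → Fin (lookup P j) → A) → Fin (Vec.sum P) → A
glue []      F = λ ()
glue (p ∷ P) F = F zero Vector.++ glue P (F ∘ suc)

∑-glue : (P : Vec ℕ k) (F : (j : Fin k) → Fin (lookup P j) → A) (G : A → ℕ) →
  sum (G ∘ glue P F) ≡ ∑[ j < k ] sum (G ∘ F j)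
∑-glue []      F G = refl
∑-glue (p ∷ P) F G = begin
  sum (G ∘ glue (p ∷ P) F)                              ≡⟨ sum-cong-≗ (λ x → [,]-∘ G (splitAt p x)) ⟩
  sum ((G ∘ F zero) Vector.++ (G ∘ glue P (F ∘ suc)))   ≡⟨ ∑-++ (G ∘ F zero) _ ⟩
  sum (G ∘ F zero) + sum (G ∘ glue P (F ∘ suc))         ≡⟨ cong (sum (G ∘ F zero) +_) (∑-glue P (F ∘ suc) G) ⟩
  sum (G ∘ F zero) + ∑[ j < _ ] sum (G ∘ F (suc j))     ∎
  where open ≡-Reasoning

glue-image : (P : Vec ℕ k) (F : (j : Fin k) → Fin (lookup P j) → A) →
  ∀ x → ∃₂ λ j b → glue P F x ≡ F j b
glue-image (p ∷ P) F x with splitAt p x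
... | inj₁ b = zero , b , refl
... | inj₂ y with j , b , eq ← glue-image P (F ∘ suc) y = suc j , b , eq

glue-injective : (P : Vec ℕ k) (F : (j : Fin k) → Fin (lookup P j) → A) →
  (∀ j → Injective _≡_ _≡_ (F j)) → (∀ i j → i ≢ j → ∀ a b → F i a ≢ F j b) →
  Injective _≡_ _≡_ (glue P F)
glue-injective (p ∷ P) F F-inj F-disjoint = splitAt-injective p ∘ [,]-injective
  (F-inj zero)
  (glue-injective P (F ∘ suc) (F-inj ∘ suc) (λ i j i≢j → F-disjoint (suc i) (suc j) (i≢j ∘ Fin.suc-injective)))
  (λ a y → let j , b , eq = glue-image P (F ∘ suc) y in
    λ a≡y → F-disjoint zero (suc j) (λ ()) a b (trans a≡y eq))

∑-blocks : (P : Vec ℕ k) (F : (j : Fin k) → Fin (lookup P j) → Fin (Vec.sum P)) →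
  (∀ j → Injective _≡_ _≡_ (F j)) → (∀ i j → i ≢ j → ∀ a b → F i a ≢ F j b) →
  (G : Fin (Vec.sum P) → ℕ) → ∑[ j < k ] ∑[ b < lookup P j ] G (F j b) ≡ sum G
∑-blocks P F F-inj F-disjoint G =
  trans (sym (∑-glue P F G)) (∑-injective (glue-injective P F F-inj F-disjoint) G)

δ : Fin n → Fin n → ℕ
δ x y with x ≟ y
... | yes _ = 1
... | no  _ = 0

δ-refl : (x : Fin n) → δ x x ≡ 1
δ-refl x with x ≟ x
... | yes _   = refl
... | no  x≢x = contradiction refl x≢x

δ-≢ : {x y : Fin n} → x ≢ y → δ x y ≡ 0
δ-≢ {x = x} {y} x≢y with x ≟ y
... | yes x≡y = contradiction x≡y x≢y
... | no  _   = refl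

δ-injective : {f : Fin m → Fin n} → Injective _≡_ _≡_ f → ∀ x y → δ (f x) (f y) ≡ δ x y
δ-injective f-inj x y = case x ≟ y of λ where
  (yes refl) → trans (δ-refl _) (sym (δ-refl x))
  (no  x≢y)  → trans (δ-≢ (x≢y ∘ f-inj)) (sym (δ-≢ x≢y))

∑-δˡ : (y : Fin n) → ∑[ x < n ] δ x y ≡ 1
∑-δˡ y = trans (∑-support (λ x → δ x y) y (λ _ → δ-≢)) (δ-refl y)

∑-δʳ : (x : Fin n) → ∑[ y < n ] δ x y ≡ 1
∑-δʳ x = trans (∑-support (δ x) x (λ _ y≢x → δ-≢ (y≢x ∘ sym))) (δ-refl x)

fromℚᵘ-homo-+ : ∀ p q → ℚ.fromℚᵘ (p ℚᵘ.+ q) ≡ ℚ.fromℚᵘ p ℚ.+ ℚ.fromℚᵘ q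
fromℚᵘ-homo-+ p q = ℚ.toℚᵘ-injective (begin-equality
  ℚ.toℚᵘ (ℚ.fromℚᵘ (p ℚᵘ.+ q))                  ≃⟨ ℚ.toℚᵘ-fromℚᵘ (p ℚᵘ.+ q) ⟩
  p ℚᵘ.+ q                                      ≃⟨ ℚᵘ.+-cong (ℚ.toℚᵘ-fromℚᵘ p) (ℚ.toℚᵘ-fromℚᵘ q) ⟨
  ℚ.toℚᵘ (ℚ.fromℚᵘ p) ℚᵘ.+ ℚ.toℚᵘ (ℚ.fromℚᵘ q)  ≃⟨ ℚ.toℚᵘ-homo-+ (ℚ.fromℚᵘ p) (ℚ.fromℚᵘ q) ⟨
  ℚ.toℚᵘ (ℚ.fromℚᵘ p ℚ.+ ℚ.fromℚᵘ q)            ∎)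
  where open ℚᵘ.≤-Reasoning

fromℚᵘ-homo-* : ∀ p q → ℚ.fromℚᵘ (p ℚᵘ.* q) ≡ ℚ.fromℚᵘ p ℚ.* ℚ.fromℚᵘ q
fromℚᵘ-homo-* p q = ℚ.toℚᵘ-injective (begin-equality
  ℚ.toℚᵘ (ℚ.fromℚᵘ (p ℚᵘ.* q))                  ≃⟨ ℚ.toℚᵘ-fromℚᵘ (p ℚᵘ.* q) ⟩
  p ℚᵘ.* q                                      ≃⟨ ℚᵘ.*-cong (ℚ.toℚᵘ-fromℚᵘ p) (ℚ.toℚᵘ-fromℚᵘ q) ⟨
  ℚ.toℚᵘ (ℚ.fromℚᵘ p) ℚᵘ.* ℚ.toℚᵘ (ℚ.fromℚᵘ q)  ≃⟨ ℚ.toℚᵘ-homo-* (ℚ.fromℚᵘ p) (ℚ.fromℚᵘ q) ⟨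
  ℚ.toℚᵘ (ℚ.fromℚᵘ p ℚ.* ℚ.fromℚᵘ q)            ∎)
  where open ℚᵘ.≤-Reasoning

ℕtoℚᵘ : ℕ → ℚᵘ.ℚᵘ
ℕtoℚᵘ n = ℚᵘ.mkℚᵘ (ℤ.+ n) 0

ℕtoℚ-homo-+ : ∀ m n → ℕtoℚ (m + n) ≡ ℕtoℚ m ℚ.+ ℕtoℚ n
ℕtoℚ-homo-+ m n = trans
  (ℚ.fromℚᵘ-cong {ℕtoℚᵘ (m + n)} {ℕtoℚᵘ m ℚᵘ.+ ℕtoℚᵘ n}
    (ℚᵘ.*≡* (cong (ℤ._* ℤ.+ 1) (cong₂ ℤ._+_ (sym (ℤ.*-identityʳ (ℤ.+ m))) (sym (ℤ.*-identityʳ (ℤ.+ n)))))))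
  (fromℚᵘ-homo-+ (ℕtoℚᵘ m) (ℕtoℚᵘ n))

ℕtoℚ-homo-* : ∀ m n → ℕtoℚ (m * n) ≡ ℕtoℚ m ℚ.* ℕtoℚ n
ℕtoℚ-homo-* m n = trans
  (ℚ.fromℚᵘ-cong {ℕtoℚᵘ (m * n)} {ℕtoℚᵘ m ℚᵘ.* ℕtoℚᵘ n} (ℚᵘ.*≡* (cong (ℤ._* ℤ.+ 1) (ℤ.pos-* m n))))
  (fromℚᵘ-homo-* (ℕtoℚᵘ m) (ℕtoℚᵘ n))

Σℚ-ℕtoℚ-* : (f : Fin k → ℕ) (c : ℚ) → Σℚ (λ l → ℕtoℚ (f l) ℚ.* c) ≡ ℕtoℚ (sum f) ℚ.* c
Σℚ-ℕtoℚ-* {zero}  f c = sym (ℚ.*-zeroˡ c)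
Σℚ-ℕtoℚ-* {suc k} f c = begin
  ℕtoℚ (f zero) ℚ.* c ℚ.+ Σℚ (λ l → ℕtoℚ (f (suc l)) ℚ.* c)  ≡⟨ cong (ℕtoℚ (f zero) ℚ.* c ℚ.+_) (Σℚ-ℕtoℚ-* (f ∘ suc) c) ⟩
  ℕtoℚ (f zero) ℚ.* c ℚ.+ ℕtoℚ (sum (f ∘ suc)) ℚ.* c         ≡⟨ ℚ.*-distribʳ-+ c (ℕtoℚ (f zero)) _ ⟨
  (ℕtoℚ (f zero) ℚ.+ ℕtoℚ (sum (f ∘ suc))) ℚ.* c             ≡⟨ cong (ℚ._* c) (ℕtoℚ-homo-+ (f zero) _) ⟨
  ℕtoℚ (sum f) ℚ.* c                                         ∎
  where open ≡-Reasoning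

-- Scaled ROSs

-- An ROS multiplied by the positive integer `weight`, without the row sums
-- for i = j: as count i i l = 0 for l ≠ i, those only prescribe count i i i,
-- which ScaledROS⇒ROS overrides.
record ScaledROS (p : Vector ℕ k) : Set where
  field
    weight       : ℕ
    {{weight≢0}} : NonZero weight
    count        : Fin k → Fin k → Fin k → ℕ
    sym₁₂        : ∀ i j l → count i j l ≡ count j i l
    sym₂₃        : ∀ i j l → count i j l ≡ count i l j
    vanish       : ∀ i l → i ≢ l → count i i l ≡ 0
    rowsum       : ∀ i j → i ≢ j → ∑[ l < k ] count i j l ≡ weight * (p i * p j)

module _ {P : Vec ℕ k} (S : ScaledROS (lookup P)) where
  open ScaledROS S

  private
    p : Fin k → ℕ
    p = lookup P

    fullCount : Fin k → Fin k → Fin k → ℕ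
    fullCount i j l with (i ≟ j) ×-dec (j ≟ l)
    ... | yes _ = weight * (p i * p i)
    ... | no  _ = count i j l

    fullCount-off : ∀ {i j l} → ¬ (i ≡ j × j ≡ l) → fullCount i j l ≡ count i j l
    fullCount-off {i} {j} {l} off with (i ≟ j) ×-dec (j ≟ l)
    ... | yes diag = contradiction diag off
    ... | no  _    = refl

    fullCount-diag : ∀ i → fullCount i i i ≡ weight * (p i * p i)
    fullCount-diag i with (i ≟ i) ×-dec (i ≟ i)
    ... | yes _   = refl
    ... | no  off = contradiction (refl , refl) off

    fullCount-sym₁₂ : ∀ i j l → fullCount i j l ≡ fullCount j i l
    fullCount-sym₁₂ i j l = case i ≟ j of λ where
      (yes refl) → refl
      (no  i≢j)  → trans (fullCount-off (i≢j ∘ proj₁))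
                     (trans (sym₁₂ i j l) (sym (fullCount-off (i≢j ∘ sym ∘ proj₁))))

    fullCount-sym₂₃ : ∀ i j l → fullCount i j l ≡ fullCount i l j
    fullCount-sym₂₃ i j l = case j ≟ l of λ where
      (yes refl) → refl
      (no  j≢l)  → trans (fullCount-off (j≢l ∘ proj₂))
                     (trans (sym₂₃ i j l) (sym (fullCount-off (j≢l ∘ sym ∘ proj₂))))

    fullCount-rowsum : ∀ i j → sum (fullCount i j) ≡ weight * (p i * p j)
    fullCount-rowsum i j = case i ≟ j of λ where
      (yes refl) → trans (∑-support (fullCount i i) i (λ l l≢i →
                           trans (fullCount-off (l≢i ∘ sym ∘ proj₂)) (vanish i l (l≢i ∘ sym))))
                         (fullCount-diag i)
      (no  i≢j)  → trans (sum-cong-≗ {k} (λ l → fullCount-off (i≢j ∘ proj₁))) (rowsum i j i≢j)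

    instance
      weight-pos : ℚ.Positive (ℕtoℚ weight)
      weight-pos = ℚ.normalize-pos weight 1

      weight≢0ℚ : ℚ.NonZero (ℕtoℚ weight)
      weight≢0ℚ = ℚ.pos⇒nonZero (ℕtoℚ weight)

      weight⁻¹-nonNeg : ℚ.NonNegative (1/ ℕtoℚ weight)
      weight⁻¹-nonNeg = ℚ.pos⇒nonNeg (1/ ℕtoℚ weight) {{ℚ.1/pos⇒pos (ℕtoℚ weight)}}

    scaled : ℕ → ℚ
    scaled c = ℕtoℚ c ℚ.* 1/ ℕtoℚ weight

    scaled-nonNeg : ∀ c → 0ℚ ℚ.≤ scaled c
    scaled-nonNeg c = ℚ.nonNegative⁻¹ (scaled c)
      {{ℚ.nonNeg*nonNeg⇒nonNeg (ℕtoℚ c) {{ℚ.normalize-nonNeg c 1}} (1/ ℕtoℚ weight)}}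

    scaled-weight : ∀ c → scaled (weight * c) ≡ ℕtoℚ c
    scaled-weight c = begin
      ℕtoℚ (weight * c) ℚ.* w⁻¹         ≡⟨ cong (ℚ._* w⁻¹) (trans (ℕtoℚ-homo-* weight c) (ℚ.*-comm (ℕtoℚ weight) (ℕtoℚ c))) ⟩
      ℕtoℚ c ℚ.* ℕtoℚ weight ℚ.* w⁻¹    ≡⟨ ℚ.*-assoc (ℕtoℚ c) (ℕtoℚ weight) w⁻¹ ⟩
      ℕtoℚ c ℚ.* (ℕtoℚ weight ℚ.* w⁻¹)  ≡⟨ cong (ℕtoℚ c ℚ.*_) (ℚ.*-inverseʳ (ℕtoℚ weight)) ⟩
      ℕtoℚ c ℚ.* 1ℚ                     ≡⟨ ℚ.*-identityʳ (ℕtoℚ c) ⟩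
      ℕtoℚ c                            ∎
      where
      open ≡-Reasoning
      w⁻¹ : ℚ
      w⁻¹ = 1/ ℕtoℚ weight

  ScaledROS⇒ROS : ROS P
  ScaledROS⇒ROS = record
    { O       = λ i j l → scaled (fullCount i j l)
    ; sym₁₂   = λ i j l → cong scaled (fullCount-sym₁₂ i j l)
    ; sym₂₃   = λ i j l → cong scaled (fullCount-sym₂₃ i j l)
    ; nonneg  = λ i j l → scaled-nonNeg (fullCount i j l)
    ; rowsum  = λ i j → trans (Σℚ-ℕtoℚ-* (fullCount i j) _)
                          (trans (cong scaled (fullCount-rowsum i j)) (scaled-weight (p i * p j)))
    ; diag    = λ i → trans (cong scaled (fullCount-diag i)) (scaled-weight (p i * p i))
    ; offdiag = λ i j i≢j → trans (cong scaled (trans (fullCount-off (i≢j ∘ proj₂)) (vanish i j i≢j)))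
                              (ℚ.*-zeroˡ (1/ ℕtoℚ weight))
    }

ScaledROS-resp-↭ : {xs : Vector ℕ m} {ys : Vector ℕ n} → xs ↭ ys → ScaledROS xs → ScaledROS ys
ScaledROS-resp-↭ {m} {n} {xs} {ys} (ρ , xs∘ρ≗ys) S = record
  { weight = weight
  ; count  = λ i j l → count (π i) (π j) (π l)
  ; sym₁₂  = λ i j l → sym₁₂ (π i) (π j) (π l)
  ; sym₂₃  = λ i j l → sym₂₃ (π i) (π j) (π l)
  ; vanish = λ i l i≢l → vanish (π i) (π l) (i≢l ∘ π-injective)
  ; rowsum = λ i j i≢j → begin
      sum (count (π i) (π j) ∘ π)     ≡⟨ ∑-permute (count (π i) (π j)) ρ ⟨
      sum (count (π i) (π j))         ≡⟨ rowsum (π i) (π j) (i≢j ∘ π-injective) ⟩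
      weight * (xs (π i) * xs (π j))  ≡⟨ cong₂ (λ x y → weight * (x * y)) (xs∘ρ≗ys i) (xs∘ρ≗ys j) ⟩
      weight * (ys i * ys j)          ∎
  }
  where
  open ScaledROS S
  open ≡-Reasoning
  π : Fin n → Fin m
  π = ρ ⟨$⟩ʳ_
  π-injective : Injective _≡_ _≡_ π
  π-injective = Injection.injective (↔⇒↣ ρ)

combine : {pa pb px : Vector ℕ k} (α β : ℕ) {{_ : NonZero (α + β)}} →
  (∀ i j → i ≢ j → α * (pa i * pa j) + β * (pb i * pb j) ≡ (α + β) * (px i * px j)) →
  ScaledROS pa → ScaledROS pb → ScaledROS px
combine {k} {pa} {pb} {px} α β mix A B = record
  { weight   = (α + β) * (A.weight * B.weight)
  ; weight≢0 = ℕ.m*n≢0 (α + β) _ {{it}} {{ℕ.m*n≢0 A.weight B.weight}}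
  ; count    = λ i j l → blend (A.count i j l) (B.count i j l)
  ; sym₁₂    = λ i j l → cong₂ blend (A.sym₁₂ i j l) (B.sym₁₂ i j l)
  ; sym₂₃    = λ i j l → cong₂ blend (A.sym₂₃ i j l) (B.sym₂₃ i j l)
  ; vanish   = λ i l i≢l → trans (cong₂ blend (A.vanish i l i≢l) (B.vanish i l i≢l))
                                  (cong₂ _+_ (ℕ.*-zeroʳ (α * B.weight)) (ℕ.*-zeroʳ (β * A.weight)))
  ; rowsum   = rowsum
  }
  where
  module A = ScaledROS A
  module B = ScaledROS B
  open +-*-Solver

  blend : ℕ → ℕ → ℕ
  blend a b = α * B.weight * a + β * A.weight * b

  rowsum : ∀ i j → i ≢ j →
    ∑[ l < k ] blend (A.count i j l) (B.count i j l) ≡ (α + β) * (A.weight * B.weight) * (px i * px j)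
  rowsum i j i≢j = begin
    sum (λ l → blend (A.count i j l) (B.count i j l))
      ≡⟨ ∑-distrib-+ (λ l → α * B.weight * A.count i j l) (λ l → β * A.weight * B.count i j l) ⟩
    sum (λ l → α * B.weight * A.count i j l) + sum (λ l → β * A.weight * B.count i j l)
      ≡⟨ cong₂ _+_ (*-distribˡ-sum (α * B.weight) (A.count i j)) (*-distribˡ-sum (β * A.weight) (B.count i j)) ⟨
    blend (sum (A.count i j)) (sum (B.count i j))
      ≡⟨ cong₂ blend (A.rowsum i j i≢j) (B.rowsum i j i≢j) ⟩
    blend (A.weight * (pa i * pa j)) (B.weight * (pb i * pb j))
      ≡⟨ solve 6 (λ a b u v x y → a :* v :* (u :* x) :+ b :* u :* (v :* y) := u :* v :* (a :* x :+ b :* y))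
           refl α β A.weight B.weight (pa i * pa j) (pb i * pb j) ⟩
    A.weight * B.weight * (α * (pa i * pa j) + β * (pb i * pb j))
      ≡⟨ cong (A.weight * B.weight *_) (mix i j i≢j) ⟩
    A.weight * B.weight * ((α + β) * (px i * px j))
      ≡⟨ solve 4 (λ u v c z → u :* v :* (c :* z) := c :* (u :* v) :* z) refl A.weight B.weight (α + β) (px i * px j) ⟩
    (α + β) * (A.weight * B.weight) * (px i * px j)
      ∎
    where open ≡-Reasoning

interpolate-head : ∀ xs {lo mid hi} → lo ≤ mid → mid ≤ hi →
  ScaledROS (List.lookup (hi List.∷ xs)) → ScaledROS (List.lookup (lo List.∷ xs)) →
  ScaledROS (List.lookup (mid List.∷ xs))
interpolate-head xs {lo} lo≤mid mid≤hi A B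
  with e , refl ← ℕ.m≤n⇒∃[o]m+o≡n lo≤mid | f , refl ← ℕ.m≤n⇒∃[o]m+o≡n mid≤hi
  with e
... | zero   = subst (λ x → ScaledROS (List.lookup (x List.∷ xs))) (sym (ℕ.+-identityʳ lo)) B
... | suc e′ = combine (suc e′) f mix A B
  where
  open +-*-Solver
  hiParts midParts loParts : Fin (suc (List.length xs)) → ℕ
  hiParts  = List.lookup (lo + suc e′ + f List.∷ xs)
  midParts = List.lookup (lo + suc e′ List.∷ xs)
  loParts  = List.lookup (lo List.∷ xs)

  mediantʳ : ∀ lo e f q → e * ((lo + e + f) * q) + f * (lo * q) ≡ (e + f) * ((lo + e) * q)
  mediantʳ = solve 4 (λ lo e f q → e :* ((lo :+ e :+ f) :* q) :+ f :* (lo :* q) := (e :+ f) :* ((lo :+ e) :* q)) refl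

  mediantˡ : ∀ lo e f q → e * (q * (lo + e + f)) + f * (q * lo) ≡ (e + f) * (q * (lo + e))
  mediantˡ = solve 4 (λ lo e f q → e :* (q :* (lo :+ e :+ f)) :+ f :* (q :* lo) := (e :+ f) :* (q :* (lo :+ e))) refl

  mix : ∀ i j → i ≢ j →
    suc e′ * (hiParts i * hiParts j) + f * (loParts i * loParts j) ≡ (suc e′ + f) * (midParts i * midParts j)
  mix zero    zero    0≢0 = contradiction refl 0≢0
  mix zero    (suc j) _   = mediantʳ lo (suc e′) f (List.lookup xs j)
  mix (suc i) zero    _   = mediantˡ lo (suc e′) f (List.lookup xs i)
  mix (suc i) (suc j) _   = sym (ℕ.*-distribʳ-+ _ (suc e′) f)

-- Latin squares with disjoint subsquares

module Symmetrization {p : Vector ℕ k} (N : Fin k → Fin k → Fin k → ℕ)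
  (margin₃ : ∀ i j → ∑[ l < k ] N i j l ≡ p i * p j)
  (margin₂ : ∀ i l → ∑[ j < k ] N i j l ≡ p i * p l)
  (margin₁ : ∀ j l → ∑[ i < k ] N i j l ≡ p j * p l)
  (vanish₃ : ∀ i l → i ≢ l → N i i l ≡ 0)
  (vanish₂ : ∀ i l → i ≢ l → N i l i ≡ 0)
  (vanish₁ : ∀ i l → i ≢ l → N l i i ≡ 0)
  where

  open +-*-Solver

  cyclic : Fin k → Fin k → Fin k → ℕ
  cyclic i j l = N i j l + N j l i + N l i j

  total : Fin k → Fin k → Fin k → ℕ
  total i j l = cyclic i j l + cyclic j i l

  cyclic-rotate : ∀ i j l → cyclic i j l ≡ cyclic j l i
  cyclic-rotate i j l = solve 3 (λ a b c → a :+ b :+ c := b :+ c :+ a) refl (N i j l) (N j l i) (N l i j)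

  total-sym₁₂ : ∀ i j l → total i j l ≡ total j i l
  total-sym₁₂ i j l = ℕ.+-comm (cyclic i j l) (cyclic j i l)

  total-sym₂₃ : ∀ i j l → total i j l ≡ total i l j
  total-sym₂₃ i j l = begin
    cyclic i j l + cyclic j i l  ≡⟨ ℕ.+-comm (cyclic i j l) _ ⟩
    cyclic j i l + cyclic i j l  ≡⟨ cong₂ _+_ (cyclic-rotate j i l) (cyclic-rotate i j l) ⟩
    cyclic i l j + cyclic j l i  ≡⟨ cong (cyclic i l j +_) (cyclic-rotate j l i) ⟩
    cyclic i l j + cyclic l i j  ∎
    where open ≡-Reasoning

  ∑-cyclic : ∀ i j → ∑[ l < k ] cyclic i j l ≡ p i * p j + p j * p i + p i * p j
  ∑-cyclic i j = begin
    sum (λ l → N i j l + N j l i + N l i j)                  ≡⟨ ∑-distrib-+ (λ l → N i j l + N j l i) (λ l → N l i j) ⟩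
    sum (λ l → N i j l + N j l i) + sum (λ l → N l i j)      ≡⟨ cong (_+ sum (λ l → N l i j)) (∑-distrib-+ (N i j) (λ l → N j l i)) ⟩
    sum (N i j) + sum (λ l → N j l i) + sum (λ l → N l i j)  ≡⟨ cong₂ _+_ (cong₂ _+_ (margin₃ i j) (margin₂ j i)) (margin₁ i j) ⟩
    p i * p j + p j * p i + p i * p j                        ∎
    where open ≡-Reasoning

  ∑-total : ∀ i j → ∑[ l < k ] total i j l ≡ 6 * (p i * p j)
  ∑-total i j = begin
    sum (total i j)                                  ≡⟨ ∑-distrib-+ (cyclic i j) (cyclic j i) ⟩
    sum (cyclic i j) + sum (cyclic j i)              ≡⟨ cong₂ _+_ (∑-cyclic i j) (∑-cyclic j i) ⟩
    x * y + y * x + x * y + (y * x + x * y + y * x)  ≡⟨ solve 2 (λ x y → x :* y :+ y :* x :+ x :* y :+ (y :* x :+ x :* y :+ y :* x)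
                                                                       := con 6 :* (x :* y)) refl x y ⟩
    6 * (x * y)                                      ∎
    where
    open ≡-Reasoning
    x y : ℕ
    x = p i
    y = p j

  total-vanish : ∀ i l → i ≢ l → total i i l ≡ 0
  total-vanish i l i≢l rewrite vanish₃ i l i≢l | vanish₂ i l i≢l | vanish₁ i l i≢l = refl

  scaledROS : ScaledROS p
  scaledROS = record
    { weight = 6
    ; count  = total
    ; sym₁₂  = total-sym₁₂
    ; sym₂₃  = total-sym₂₃
    ; vanish = total-vanish
    ; rowsum = λ i j _ → ∑-total i j
    }

module Counting {P : Vec ℕ k} (ls : LS P) where

  private
    order : ℕ
    order = Vec.sum P

    p : Fin k → ℕ
    p = lookup P

    L : Fin order → Fin order → Fin order
    L = proj₁ ls

    row-injective : ∀ r → Injective _≡_ _≡_ (L r)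
    row-injective = proj₁ (proj₁ (proj₂ ls))

    col-injective : ∀ c → Injective _≡_ _≡_ (λ r → L r c)
    col-injective = proj₂ (proj₁ (proj₂ ls))

    S : ∀ i → Subsquare order L (p i)
    S = proj₁ (proj₂ (proj₂ ls))

    R C Y : (i : Fin k) → Fin (p i) → Fin order
    R i = rows (S i)
    C i = cols (S i)
    Y i = syms (S i)

    rows-disjoint : ∀ i j → i ≢ j → ∀ a b → R i a ≢ R j b
    rows-disjoint i j = proj₁ ∘ proj₂ (proj₂ (proj₂ ls)) i j

    cols-disjoint : ∀ i j → i ≢ j → ∀ a b → C i a ≢ C j b
    cols-disjoint i j = proj₁ ∘ proj₂ ∘ proj₂ (proj₂ (proj₂ ls)) i j

    syms-disjoint : ∀ i j → i ≢ j → ∀ a b → Y i a ≢ Y j b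
    syms-disjoint i j = proj₂ ∘ proj₂ ∘ proj₂ (proj₂ (proj₂ ls)) i j

  inBlock : Fin k → Fin order → ℕ
  inBlock l s = ∑[ c < p l ] δ (Y l c) s

  cellCount : Fin k → Fin k → Fin k → ℕ
  cellCount i j l = ∑[ a < p i ] ∑[ b < p j ] inBlock l (L (R i a) (C j b))

  ∑-inBlock-symbols : ∀ l → ∑[ s < order ] inBlock l s ≡ p l
  ∑-inBlock-symbols l = begin
    ∑[ s < order ] ∑[ c < p l ] δ (Y l c) s  ≡⟨ ∑-comm (λ s c → δ (Y l c) s) ⟩
    ∑[ c < p l ] ∑[ s < order ] δ (Y l c) s  ≡⟨ sum-cong-≗ (∑-δʳ ∘ Y l) ⟩
    ∑[ c < p l ] 1                       ≡⟨ ∑-const (p l) 1 ⟩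
    p l * 1                              ≡⟨ ℕ.*-identityʳ (p l) ⟩
    p l                                  ∎
    where open ≡-Reasoning

  ∑-inBlock-blocks : ∀ s → ∑[ l < k ] inBlock l s ≡ 1
  ∑-inBlock-blocks s =
    trans (∑-blocks P Y (syms-inj ∘ S) syms-disjoint (λ x → δ x s)) (∑-δˡ s)

  inBlock-own : ∀ i c → inBlock i (Y i c) ≡ 1
  inBlock-own i c = trans (sum-cong-≗ (λ c′ → δ-injective (syms-inj (S i)) c′ c)) (∑-δˡ c)

  inBlock-other : ∀ i l c → i ≢ l → inBlock l (Y i c) ≡ 0
  inBlock-other i l c i≢l = ∑-zero _ (λ c′ → δ-≢ (syms-disjoint l i (i≢l ∘ sym) c′ c))

  ∑-inBlock-row : ∀ r l → ∑[ c < order ] inBlock l (L r c) ≡ p l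
  ∑-inBlock-row r l = trans (∑-injective (row-injective r) (inBlock l)) (∑-inBlock-symbols l)

  ∑-inBlock-col : ∀ c l → ∑[ r < order ] inBlock l (L r c) ≡ p l
  ∑-inBlock-col c l = trans (∑-injective (col-injective c) (inBlock l)) (∑-inBlock-symbols l)

  margin₃ : ∀ i j → ∑[ l < k ] cellCount i j l ≡ p i * p j
  margin₃ i j = begin
    ∑[ l < k ] ∑[ a < p i ] ∑[ b < p j ] inBlock l (L (R i a) (C j b))  ≡⟨ ∑-comm (λ l a → ∑[ b < p j ] inBlock l (L (R i a) (C j b))) ⟩
    ∑[ a < p i ] ∑[ l < k ] ∑[ b < p j ] inBlock l (L (R i a) (C j b))  ≡⟨ sum-cong-≗ (λ a → ∑-comm (λ l b → inBlock l (L (R i a) (C j b)))) ⟩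
    ∑[ a < p i ] ∑[ b < p j ] ∑[ l < k ] inBlock l (L (R i a) (C j b))  ≡⟨ ∑∑-ones (p i) (p j) _ (λ a b → ∑-inBlock-blocks _) ⟩
    p i * p j                                                          ∎
    where open ≡-Reasoning

  margin₂ : ∀ i l → ∑[ j < k ] cellCount i j l ≡ p i * p l
  margin₂ i l = begin
    ∑[ j < k ] ∑[ a < p i ] ∑[ b < p j ] inBlock l (L (R i a) (C j b))  ≡⟨ ∑-comm (λ j a → ∑[ b < p j ] inBlock l (L (R i a) (C j b))) ⟩
    ∑[ a < p i ] ∑[ j < k ] ∑[ b < p j ] inBlock l (L (R i a) (C j b))  ≡⟨ sum-cong-≗ along-row ⟩
    ∑[ a < p i ] p l                                                   ≡⟨ ∑-const (p i) (p l) ⟩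
    p i * p l                                                          ∎
    where
    open ≡-Reasoning
    along-row : ∀ a → ∑[ j < k ] ∑[ b < p j ] inBlock l (L (R i a) (C j b)) ≡ p l
    along-row a = trans (∑-blocks P C (cols-inj ∘ S) cols-disjoint (inBlock l ∘ L (R i a)))
                        (∑-inBlock-row (R i a) l)

  margin₁ : ∀ j l → ∑[ i < k ] cellCount i j l ≡ p j * p l
  margin₁ j l = begin
    ∑[ i < k ] ∑[ a < p i ] ∑[ b < p j ] inBlock l (L (R i a) (C j b))  ≡⟨ sum-cong-≗ (λ i → ∑-comm (λ a b → inBlock l (L (R i a) (C j b)))) ⟩
    ∑[ i < k ] ∑[ b < p j ] ∑[ a < p i ] inBlock l (L (R i a) (C j b))  ≡⟨ ∑-comm (λ i b → ∑[ a < p i ] inBlock l (L (R i a) (C j b))) ⟩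
    ∑[ b < p j ] ∑[ i < k ] ∑[ a < p i ] inBlock l (L (R i a) (C j b))  ≡⟨ sum-cong-≗ along-col ⟩
    ∑[ b < p j ] p l                                                   ≡⟨ ∑-const (p j) (p l) ⟩
    p j * p l                                                          ∎
    where
    open ≡-Reasoning
    along-col : ∀ b → ∑[ i < k ] ∑[ a < p i ] inBlock l (L (R i a) (C j b)) ≡ p l
    along-col b = trans (∑-blocks P R (rows-inj ∘ S) rows-disjoint (λ r → inBlock l (L r (C j b))))
                        (∑-inBlock-col (C j b) l)

  cellCount-diag : ∀ i → cellCount i i i ≡ p i * p i
  cellCount-diag i = ∑∑-ones (p i) (p i) _ λ a b →
    let c , eq = closed (S i) a b in trans (cong (inBlock i) eq) (inBlock-own i c)

  vanish₃ : ∀ i l → i ≢ l → cellCount i i l ≡ 0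
  vanish₃ i l i≢l = ∑-zero _ λ a → ∑-zero _ λ b →
    let c , eq = closed (S i) a b in trans (cong (inBlock l) eq) (inBlock-other i l c i≢l)

  -- The rows (columns) of Sᵢ already meet all symbols of Sᵢ inside Sᵢ.
  vanish₂ : ∀ i l → i ≢ l → cellCount i l i ≡ 0
  vanish₂ i l i≢l =
    ∑≡term⇒others≡0 (λ j → cellCount i j i) i (trans (margin₂ i i) (sym (cellCount-diag i))) l (i≢l ∘ sym)

  vanish₁ : ∀ i l → i ≢ l → cellCount l i i ≡ 0
  vanish₁ i l i≢l =
    ∑≡term⇒others≡0 (λ j → cellCount j i i) i (trans (margin₁ i i) (sym (cellCount-diag i))) l (i≢l ∘ sym)

LS⇒ScaledROS : (P : Vec ℕ k) → LS P → ScaledROS (lookup P)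
LS⇒ScaledROS P ls = Symmetrization.scaledROS cellCount margin₃ margin₂ margin₁ vanish₃ vanish₂ vanish₁
  where open Counting {P = P} ls

-- Permuting the parts

lookup-↭ : {xs ys : List A} → xs List.↭ ys → List.lookup xs ↭ List.lookup ys
lookup-↭ List.refl = Perm.id , λ _ → refl
lookup-↭ (List.prep x xs↭ys) with ρ , ρ-lookup ← lookup-↭ xs↭ys = Perm.lift₀ ρ , λ where
  zero    → refl
  (suc i) → ρ-lookup i
lookup-↭ (List.swap x y xs↭ys) with ρ , ρ-lookup ← lookup-↭ xs↭ys = Perm.swap ρ , λ where
  zero          → refl
  (suc zero)    → refl
  (suc (suc i)) → ρ-lookup i
lookup-↭ (List.trans xs↭ys ys↭zs) with ρ , ρ-lookup ← lookup-↭ xs↭ys | σ , σ-lookup ← lookup-↭ ys↭zs =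
  σ Perm.∘ₚ ρ , λ i → trans (ρ-lookup (σ ⟨$⟩ʳ i)) (σ-lookup i)

toList-↭ : (v : Vec A n) → lookup v ↭ List.lookup (toList v)
toList-↭ []      = Perm.id , λ ()
toList-↭ (x ∷ v) with ρ , ρ-lookup ← toList-↭ v = Perm.lift₀ ρ , λ where
  zero    → refl
  (suc i) → ρ-lookup i

module Staircase {k u a b : ℕ}
  (LS-exists : ∀ i → u ≤ i → i ≤ k ∸ 1 → LS (replicate i a ++ replicate (k ∸ i) b)) where

  two-valued : ∀ c m → u ≤ c → c + suc m ≡ k →
    ScaledROS (List.lookup (List.replicate c a List.++ List.replicate (suc m) b))
  two-valued c m u≤c refl =
    subst (ScaledROS ∘ List.lookup) toList-V (ScaledROS-resp-↭ (toList-↭ V) (LS⇒ScaledROS V ls))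
    where
    V : Vec ℕ (c + suc m)
    V = replicate c a ++ replicate (suc m) b

    ls : LS V
    ls = subst (λ r → LS (replicate c a ++ replicate r b)) (ℕ.m+n∸m≡n c (suc m)) (LS-exists c u≤c c≤k-1)
      where
      c≤k-1 : c ≤ c + suc m ∸ 1
      c≤k-1 = subst (c ≤_) (cong (_∸ 1) (sym (ℕ.+-suc c m))) (ℕ.m≤m+n c m)

    toList-V : toList V ≡ List.replicate c a List.++ List.replicate (suc m) b
    toList-V = trans (Vec.toList-++ (replicate c a) _)
                     (cong₂ List._++_ (Vec.toList-replicate c a) (Vec.toList-replicate (suc m) b))

  staircase : ∀ {t} (g : Vec ℕ t) c m → (∀ i → b ≤ lookup g i) → (∀ i → lookup g i ≤ a) →
    u ≤ c → t + c + suc m ≡ k →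
    ScaledROS (List.lookup (List.replicate c a List.++ toList g List.++ List.replicate (suc m) b))
  staircase []      c m _ _ u≤c len = two-valued c m u≤c len
  staircase {suc t} (x ∷ g) c m b≤g g≤a u≤c len =
    ScaledROS-resp-↭ (lookup-↭ (List.↭-sym (List.shift x As (Gs List.++ Bs))))
      (interpolate-head (As List.++ Gs List.++ Bs) (b≤g zero) (g≤a zero) with-a with-b)
    where
    As Gs Bs : List ℕ
    As = List.replicate c a
    Gs = toList g
    Bs = List.replicate (suc m) b

    with-a : ScaledROS (List.lookup (a List.∷ As List.++ Gs List.++ Bs))
    with-a = staircase g (suc c) m (b≤g ∘ suc) (g≤a ∘ suc) (ℕ.m≤n⇒m≤1+n u≤c)
               (trans (cong (_+ suc m) (ℕ.+-suc t c)) len)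

    b-to-front : As List.++ Gs List.++ b List.∷ Bs List.↭ b List.∷ As List.++ Gs List.++ Bs
    b-to-front = List.↭-trans (List.++⁺ˡ As (List.shift b Gs Bs)) (List.shift b As (Gs List.++ Bs))

    with-b : ScaledROS (List.lookup (b List.∷ As List.++ Gs List.++ Bs))
    with-b = ScaledROS-resp-↭ (lookup-↭ b-to-front)
               (staircase g c (suc m) (b≤g ∘ suc) (g≤a ∘ suc) u≤c (trans (ℕ.+-suc (t + c) (suc m)) len))

parts-length : ∀ k u → 1 ≤ k → u ≤ k ∸ 1 → k ∸ u ∸ 1 + u + 1 ≡ k
parts-length (suc k) u _ u≤k = begin
  suc k ∸ u ∸ 1 + u + 1  ≡⟨ cong (λ x → x + u + 1) (trans (ℕ.∸-+-assoc (suc k) u 1) (cong (suc k ∸_) (ℕ.+-comm u 1))) ⟩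
  k ∸ u + u + 1          ≡⟨ cong (_+ 1) (ℕ.m∸n+n≡m u≤k) ⟩
  k + 1                  ≡⟨ ℕ.+-comm k 1 ⟩
  suc k                  ∎
  where open ≡-Reasoning

mainTheorem11 : (k u h₁ hₖ : ℕ) → 2 ≤ k → 1 ≤ u → u ≤ k ∸ 1 →
    1 ≤ hₖ → hₖ ≤ h₁ →
    (∀ i → u ≤ i → i ≤ k ∸ 1 → LS (replicate i h₁ ++ replicate (k ∸ i) hₖ)) →
    (g : Vec ℕ (k ∸ u ∸ 1)) →
    (∀ a → lookup g a ≤ h₁) → (∀ a → hₖ ≤ lookup g a) →
    (∀ a b → a Fin.≤ b → lookup g b ≤ lookup g a) →
    ROS (replicate u h₁ ++ g ++ [ hₖ ])
mainTheorem11 k u h₁ hₖ 2≤k _ u≤k-1 _ _ LS-exists g g≤h₁ hₖ≤g _ =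
  ScaledROS⇒ROS (ScaledROS-resp-↭ (↭-sym {x = lookup V} (toList-↭ V))
    (subst (ScaledROS ∘ List.lookup) (sym toList-V)
      (staircase g u 0 hₖ≤g g≤h₁ ℕ.≤-refl (parts-length k u (ℕ.≤-trans (s≤s z≤n) 2≤k) u≤k-1))))
  where
  open Staircase LS-exists
  V : Vec ℕ (u + (k ∸ u ∸ 1 + 1))
  V = replicate u h₁ ++ g ++ [ hₖ ]
  toList-V : toList V ≡ List.replicate u h₁ List.++ toList g List.++ List.replicate 1 hₖ
  toList-V = trans (Vec.toList-++ (replicate u h₁) (g ++ [ hₖ ]))
                   (cong₂ List._++_ (Vec.toList-replicate u h₁) (Vec.toList-++ g [ hₖ ]))
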